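{- Every niche-realizable graph is perfect.
   Context: All graphs are simple. A bipartite tournament is an orientation of a complete bipartite graph. The niche graph of a digraph $D$ is the graph with vertex set $V(D)$ in which distinct $u,v$ are adjacent iff there is a vertex $w$ with $(u,w),(v,w)\in A(D)$, or with $(w,u),(w,v)\in A(D)$. A graph is niche-realizable if it is the niche graph of some bipartite tournament. -}

module Defs where

open import Data.Nat using (ℕ; _≤_)
open import Data.Fin using (Fin)
open import Data.Bool using (Bool; true; false)
open import Data.Product using (Σ; ∃; ∃-syntax; _×_; _,_)
open import Data.Sum using (_⊎_)
open import Relation.Binary.PropositionalEquality using (_≡_; _≢_)
open import Function.Bundles using (_⇔_)
open import Function.Definitions using (Injective)

record Graph (n : ℕ) : Set where
  field
    Adj   : Fin n → Fin n → Bool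
    sym   : ∀ u v → Adj u v ≡ Adj v u
    irrefl : ∀ v → Adj v v ≡ false
open Graph public

record BipartiteTournament (n : ℕ) : Set where
  field
    part   : Fin n → Bool
    Arc    : Fin n → Fin n → Bool
    arc-cross : ∀ u v → Arc u v ≡ true → part u ≢ part v
    arc-total : ∀ u v → part u ≢ part v → (Arc u v ≡ true ⊎ Arc v u ≡ true)
    arc-asym  : ∀ u v → Arc u v ≡ true → Arc v u ≡ false
open BipartiteTournament public

IsNicheGraphOf : ∀ {n} → Graph n → BipartiteTournament n → Set
IsNicheGraphOf {n} G D =
  ∀ (u v : Fin n) →
    (Adj G u v ≡ true) ⇔
      (u ≢ v × ∃[ w ] ((Arc D u w ≡ true × Arc D v w ≡ true)
                      ⊎ (Arc D w u ≡ true × Arc D w v ≡ true)))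

NicheRealizable : ∀ {n} → Graph n → Set
NicheRealizable {n} G = ∃[ D ] IsNicheGraphOf {n} G D

Colorable : ∀ {n} → Graph n → ℕ → Set
Colorable {n} G k =
  Σ (Fin n → Fin k) λ c → ((u v : Fin n) → Adj G u v ≡ true → c u ≢ c v)

HasClique : ∀ {n} → Graph n → ℕ → Set
HasClique {n} G k =
  Σ (Fin k → Fin n) λ f →
    Injective _≡_ _≡_ f × (∀ i j → i ≢ j → Adj G (f i) (f j) ≡ true)

IsChromaticNumber : ∀ {n} → Graph n → ℕ → Set
IsChromaticNumber G k = Colorable G k × (∀ j → Colorable G j → k ≤ j)

IsCliqueNumber : ∀ {n} → Graph n → ℕ → Set
IsCliqueNumber G k = HasClique G k × (∀ j → HasClique G j → j ≤ k)

induced : ∀ {n m} → Graph n → (Fin m → Fin n) → Graph m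
induced G f = record
  { Adj = λ i j → Adj G (f i) (f j)
  ; sym = λ i j → sym G (f i) (f j)
  ; irrefl = λ i → irrefl G (f i)
  }

Perfect : ∀ {n} → Graph n → Set
Perfect {n} G =
  ∀ (m : ℕ) (f : Fin m → Fin n) → Injective _≡_ _≡_ f →
    ∃[ k ] (IsChromaticNumber (induced G f) k × IsCliqueNumber (induced G f) k)

-- Vertices in different parts of a bipartite tournament have no common out- or
-- in-neighbour, so every edge of the niche graph lies inside a part, and two distinct
-- vertices of one part are non-adjacent exactly when their out-neighbourhoods in the
-- other part are complementary.  If the niche graph has an edge, the other part is
-- nonempty, so non-adjacency inside a part is triangle-free and closes every path
-- w - x - y - z: each part induces the complement of a disjoint union of complete
-- bipartite graphs.  Such a graph is coloured with as many colours as one of its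
-- cliques has vertices, by induction: delete a non-adjacent pair u, v (or any vertex
-- if there is none); a triangle or an unclosed path would appear unless u or v is
-- adjacent to the whole clique found for the rest, so it extends that clique while
-- u and v share the new colour.  The two parts are coloured independently and the
-- larger clique wins.  All of this passes to induced subgraphs, and edgeless graphs
-- are trivial.

module Submission where

open import Defs hiding (sym)
open import Data.Bool using (Bool; true; false; not)
open import Data.Bool.Properties using (¬-not; not-¬; not-injective; not-involutive) renaming (_≟_ to _≟ᵇ_)
open import Data.Empty using (⊥; ⊥-elim)
open import Data.Fin using (Fin; zero; suc; fromℕ<; _≟_)
open import Data.Fin.Properties using (any?; injective⇒≤; fromℕ<-injective)
open import Data.Fin.Subset using (Subset; _∈_; _∉_; _⊆_; _⊂_; _∪_; _-_)
open import Data.Fin.Subset.Properties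
  using (_∈?_; nonempty?; p─q⊆p; x∈p∧x≢y⇒x∈p-y; x∈p⇒p-x⊂p; ⊆-⊂-trans; x∈p∪q⁺; x∈p∪q⁻)
open import Data.Fin.Subset.Induction using (Acc; acc; ⊂-wellFounded)
open import Data.List using (List; []; _∷_; length; lookup)
open import Data.List.Membership.Propositional using () renaming (_∈_ to _∈ₗ_)
open import Data.List.Membership.Propositional.Properties using (∈-lookup)
open import Data.List.Relation.Unary.All as All using (All; []; _∷_)
open import Data.List.Relation.Unary.AllPairs using (AllPairs; []; _∷_)
open import Data.List.Relation.Unary.Any using (here; there)
open import Data.Nat using (ℕ; zero; suc; _≤_; _<_)
open import Data.Nat.Properties using (<-≤-trans; ≤-total; <⇒≢; >⇒≢; n<1+n; m<n⇒m<1+n)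
open import Data.Product using (∃; ∃₂; ∃-syntax; _×_; _,_; proj₂; map₂)
open import Data.Sum using (_⊎_; inj₁; inj₂; [_,_]′; swap)
open import Data.Vec using (tabulate; _∷_; here; there)
open import Data.Vec.Properties using (lookup∘tabulate; lookup⇒[]=; []=⇒lookup)
open import Function using (_∘_; flip)
open import Function.Bundles using (Equivalence)
open import Function.Definitions using (Injective)
open import Relation.Nullary using (Dec; yes; no; ¬_; ¬?; contradiction)
open import Relation.Nullary.Decidable using (_×-dec_)
open import Relation.Binary.PropositionalEquality
  using (_≡_; _≢_; refl; sym; trans; cong; ≢-sym; module ≡-Reasoning)

a≢c∧b≢c⇒a≡b : ∀ {a b c : Bool} → a ≢ c → b ≢ c → a ≡ b
a≢c∧b≢c⇒a≡b a≢c b≢c = trans (¬-not a≢c) (sym (¬-not b≢c))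

∈-tabulate⁺ : ∀ {n} {g : Fin n → Bool} {x} → g x ≡ true → x ∈ tabulate g
∈-tabulate⁺ {g = g} {x} gx = lookup⇒[]= x (tabulate g) (trans (lookup∘tabulate g x) gx)

∈-tabulate⁻ : ∀ {n} {g : Fin n → Bool} {x} → x ∈ tabulate g → g x ≡ true
∈-tabulate⁻ {g = g} {x} x∈ = trans (sym (lookup∘tabulate g x)) ([]=⇒lookup x∈)

x∉p-x : ∀ {n} (p : Subset n) (x : Fin n) → x ∉ p - x
x∉p-x (_ ∷ p) zero    ()
x∉p-x (_ ∷ p) (suc x) (there x∈) = x∉p-x p x x∈

x∈p-y⇒x≢y : ∀ {n} {p : Subset n} {x y} → x ∈ p - y → x ≢ y
x∈p-y⇒x≢y {p = p} {x} x∈ refl = x∉p-x p x x∈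

x∈p∧x∉p-y⇒x≡y : ∀ {n} {p : Subset n} {x y} → x ∈ p → x ∉ p - y → x ≡ y
x∈p∧x∉p-y⇒x≡y {x = x} {y} x∈p x∉p-y with x ≟ y
... | yes x≡y = x≡y
... | no x≢y = contradiction (x∈p∧x≢y⇒x∈p-y x∈p x≢y) x∉p-y

p-x-y⊆p : ∀ {n} {p : Subset n} {x y} → p - x - y ⊆ p
p-x-y⊆p {p = p} {x} = p─q⊆p p _ ∘ p─q⊆p (p - x) _

x∈p⇒p-x-y⊂p : ∀ {n} {p : Subset n} {x y} → x ∈ p → p - x - y ⊂ p
x∈p⇒p-x-y⊂p {p = p} {x} x∈p = ⊆-⊂-trans (p─q⊆p (p - x) _) (x∈p⇒p-x⊂p x∈p)

x∈p∧x∉p-y-z⇒x≡y⊎x≡z : ∀ {n} {p : Subset n} {x y z} → x ∈ p → x ∉ p - y - z → x ≡ y ⊎ x ≡ z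
x∈p∧x∉p-y-z⇒x≡y⊎x≡z {p = p} {x} {y} x∈p x∉p-y-z with x ∈? p - y
... | yes x∈p-y = inj₂ (x∈p∧x∉p-y⇒x≡y x∈p-y x∉p-y-z)
... | no x∉p-y  = inj₁ (x∈p∧x∉p-y⇒x≡y x∈p x∉p-y)

module _ {n : ℕ} (G : Graph n) where

  Adjacent : Fin n → Fin n → Set
  Adjacent x y = Adj G x y ≡ true

  infix 4 _≁_
  _≁_ : Fin n → Fin n → Set
  x ≁ y = x ≢ y × Adj G x y ≡ false

  adjacent-sym : ∀ {x y} → Adjacent x y → Adjacent y x
  adjacent-sym {x} {y} adj = trans (Graph.sym G y x) adj

  nonadjacent⇒¬adjacent : ∀ {x y} → Adj G x y ≡ false → ¬ Adjacent x y
  nonadjacent⇒¬adjacent nonadj adj = contradiction (trans (sym adj) nonadj) λ ()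

  adjacent⇒≢ : ∀ {x y} → Adjacent x y → x ≢ y
  adjacent⇒≢ {x} adj refl = nonadjacent⇒¬adjacent (irrefl G x) adj

  ≁-sym : ∀ {x y} → x ≁ y → y ≁ x
  ≁-sym {x} {y} (x≢y , nonadj) = ≢-sym x≢y , trans (Graph.sym G y x) nonadj

  edge? : Dec (∃₂ λ x y → Adjacent x y)
  edge? = any? λ x → any? λ y → Adj G x y ≟ᵇ true

  -- A vertex set satisfying R induces the complement of a disjoint union of
  -- complete bipartite graphs.
  record IsCoBiclique (R : Fin n → Set) : Set where
    field
      ≁-triangle-free : ∀ {x y z} → R x → R y → R z → x ≁ y → y ≁ z → x ≁ z → ⊥
      ≁-path-closed : ∀ {w x y z} → R w → R x → R y → R z →
                      w ≁ x → x ≁ y → y ≁ z → Adj G w z ≡ false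

  ∈-clique⇒adjacent : ∀ {xs x y} → AllPairs Adjacent xs → x ∈ₗ xs → y ∈ₗ xs → x ≢ y → Adjacent x y
  ∈-clique⇒adjacent (_ ∷ _)      (here refl) (here refl) x≢y = contradiction refl x≢y
  ∈-clique⇒adjacent (x-xs ∷ _)   (here refl) (there y∈) _   = All.lookup x-xs y∈
  ∈-clique⇒adjacent (y-xs ∷ _)   (there x∈) (here refl) _   = adjacent-sym (All.lookup y-xs x∈)
  ∈-clique⇒adjacent (_ ∷ clique) (there x∈) (there y∈) x≢y = ∈-clique⇒adjacent clique x∈ y∈ x≢y

  lookup-injective : ∀ {xs} → AllPairs Adjacent xs → Injective _≡_ _≡_ (lookup xs)
  lookup-injective (_ ∷ _)      {zero}  {zero}  _  = refl
  lookup-injective (x-xs ∷ _)   {zero}  {suc j} eq =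
    contradiction eq (adjacent⇒≢ (All.lookup x-xs (∈-lookup j)))
  lookup-injective (x-xs ∷ _)   {suc i} {zero}  eq =
    contradiction (sym eq) (adjacent⇒≢ (All.lookup x-xs (∈-lookup i)))
  lookup-injective (_ ∷ clique) {suc i} {suc j} eq = cong suc (lookup-injective clique eq)

  clique⇒HasClique : ∀ {xs} → AllPairs Adjacent xs → HasClique G (length xs)
  clique⇒HasClique {xs} clique =
    lookup xs , lookup-injective clique ,
    λ i j i≢j → ∈-clique⇒adjacent clique (∈-lookup i) (∈-lookup j) (i≢j ∘ lookup-injective clique)

  bounded-colouring⇒Colorable : ∀ {k} (c : Fin n → ℕ) → (∀ x → c x < k) →
                                (∀ x y → Adjacent x y → c x ≢ c y) → Colorable G k
  bounded-colouring⇒Colorable c c<k proper =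
    (λ x → fromℕ< (c<k x)) ,
    λ x y adj eq → proper x y adj (fromℕ<-injective (c x) (c y) (c<k x) (c<k y) eq)

  colouring-bounds-clique : ∀ {j k} → Colorable G j → HasClique G k → k ≤ j
  colouring-bounds-clique (c , proper) (h , _ , h-adj) = injective⇒≤ c∘h-injective
    where
      c∘h-injective : Injective _≡_ _≡_ (c ∘ h)
      c∘h-injective {a} {b} eq with a ≟ b
      ... | yes a≡b = a≡b
      ... | no a≢b = contradiction eq (proper (h a) (h b) (h-adj a b a≢b))

  colourable∧clique⇒χ≡ω : ∀ {k} → Colorable G k → HasClique G k →
                          IsChromaticNumber G k × IsCliqueNumber G k
  colourable∧clique⇒χ≡ω col clq =
    (col , λ _ col′ → colouring-bounds-clique col′ clq) ,
    (clq , λ _ clq′ → colouring-bounds-clique col clq′)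

  record CliqueBoundedColouring (P : Subset n) : Set where
    field
      clique          : List (Fin n)
      clique-⊆        : All (_∈ P) clique
      clique-adjacent : AllPairs Adjacent clique
      colour          : Fin n → ℕ
      colour-<        : ∀ {x} → x ∈ P → colour x < length clique
      colour-proper   : ∀ {x y} → x ∈ P → y ∈ P → Adjacent x y → colour x ≢ colour y
  open CliqueBoundedColouring

  empty-colouring : ∀ {P} → ¬ (∃ λ x → x ∈ P) → CliqueBoundedColouring P
  empty-colouring empty = record
    { clique = [] ; clique-⊆ = [] ; clique-adjacent = [] ; colour = λ _ → 0
    ; colour-< = λ x∈P → contradiction (_ , x∈P) empty
    ; colour-proper = λ x∈P → contradiction (_ , x∈P) empty
    }

  extend : ∀ {P Q u} → Q ⊆ P → (C : CliqueBoundedColouring Q) → u ∈ P →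
           All (Adjacent u) (clique C) →
           (∀ {x y} → x ∈ P → x ∉ Q → y ∈ P → y ∉ Q → Adj G x y ≡ false) →
           CliqueBoundedColouring P
  extend {P} {Q} {u} Q⊆P C u∈P u-clique new-independent = record
    { clique = u ∷ clique C
    ; clique-⊆ = u∈P ∷ All.map Q⊆P (clique-⊆ C)
    ; clique-adjacent = u-clique ∷ clique-adjacent C
    ; colour = colour′
    ; colour-< = colour′-<
    ; colour-proper = colour′-proper
    }
    where
      colour′ : Fin n → ℕ
      colour′ x with x ∈? Q
      ... | yes _ = colour C x
      ... | no _ = length (clique C)

      colour′-< : ∀ {x} → x ∈ P → colour′ x < length (u ∷ clique C)
      colour′-< {x} _ with x ∈? Q
      ... | yes x∈Q = m<n⇒m<1+n (colour-< C x∈Q)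
      ... | no _ = n<1+n _

      colour′-proper : ∀ {x y} → x ∈ P → y ∈ P → Adjacent x y → colour′ x ≢ colour′ y
      colour′-proper {x} {y} x∈P y∈P adj with x ∈? Q | y ∈? Q
      ... | yes x∈Q | yes y∈Q = colour-proper C x∈Q y∈Q adj
      ... | yes x∈Q | no _    = <⇒≢ (colour-< C x∈Q)
      ... | no _    | yes y∈Q = >⇒≢ (colour-< C y∈Q)
      ... | no x∉Q  | no y∉Q  = contradiction adj (nonadjacent⇒¬adjacent (new-independent x∈P x∉Q y∈P y∉Q))

  removed-independent : ∀ {P u v} → Adj G u v ≡ false →
                        ∀ {x y} → x ∈ P → x ∉ P - u - v → y ∈ P → y ∉ P - u - v → Adj G x y ≡ false
  removed-independent {u = u} {v} uv-nonadj x∈P x∉Q y∈P y∉Q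
    with x∈p∧x∉p-y-z⇒x≡y⊎x≡z x∈P x∉Q | x∈p∧x∉p-y-z⇒x≡y⊎x≡z y∈P y∉Q
  ... | inj₁ refl | inj₁ refl = irrefl G u
  ... | inj₁ refl | inj₂ refl = uv-nonadj
  ... | inj₂ refl | inj₁ refl = trans (Graph.sym G v u) uv-nonadj
  ... | inj₂ refl | inj₂ refl = irrefl G v

  adjacent-to-all? : ∀ u xs → All (Adjacent u) xs ⊎ ∃ λ z → z ∈ₗ xs × Adj G u z ≡ false
  adjacent-to-all? u [] = inj₁ []
  adjacent-to-all? u (z ∷ xs) with Adj G u z ≟ᵇ true | adjacent-to-all? u xs
  ... | no ¬uz-adj | _                          = inj₂ (z , here refl , ¬-not ¬uz-adj)
  ... | yes _      | inj₂ (z′ , z′∈ , uz′-nonadj) = inj₂ (z′ , there z′∈ , uz′-nonadj)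
  ... | yes uz-adj | inj₁ u-xs                  = inj₁ (uz-adj ∷ u-xs)

  module _ {R : Fin n → Set} (coBiclique : IsCoBiclique R) where
    open IsCoBiclique coBiclique

    co-pair? : ∀ P → Dec (∃₂ λ u v → u ∈ P × v ∈ P × u ≁ v)
    co-pair? P = any? λ u → any? λ v →
      (u ∈? P) ×-dec (v ∈? P) ×-dec ¬? (u ≟ v) ×-dec (Adj G u v ≟ᵇ false)

    one-of-co-pair-complete : ∀ {P u v K} → (∀ {x} → x ∈ P → R x) → u ∈ P → v ∈ P → u ≁ v →
                              All (_∈ P - u - v) K → AllPairs Adjacent K →
                              All (Adjacent u) K ⊎ All (Adjacent v) K
    one-of-co-pair-complete {P} {u} {v} {K} P⊆R u∈P v∈P u≁v K⊆Q clique
      with adjacent-to-all? u K | adjacent-to-all? v K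
    ... | inj₁ u-K | _        = inj₁ u-K
    ... | inj₂ _   | inj₁ v-K = inj₂ v-K
    ... | inj₂ (z , z∈K , uz-nonadj) | inj₂ (y , y∈K , vy-nonadj) = ⊥-elim blocked
      where
        avoids : ∀ {x} → x ∈ₗ K → R x × x ≢ u × x ≢ v
        avoids {x} x∈K = P⊆R (p-x-y⊆p x∈Q) , x∈p-y⇒x≢y (p─q⊆p (P - u) _ x∈Q) , x∈p-y⇒x≢y x∈Q
          where
            x∈Q : x ∈ P - u - v
            x∈Q = All.lookup K⊆Q x∈K

        blocked : ⊥
        blocked with avoids z∈K | avoids y∈K | y ≟ z
        ... | Rz , z≢u , z≢v | _ | yes refl =
          ≁-triangle-free (P⊆R u∈P) (P⊆R v∈P) Rz u≁v (≢-sym z≢v , vy-nonadj) (≢-sym z≢u , uz-nonadj)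
        ... | Rz , z≢u , _ | Ry , _ , y≢v | no y≢z =
          nonadjacent⇒¬adjacent
            (≁-path-closed Rz (P⊆R u∈P) (P⊆R v∈P) Ry
              (≁-sym (≢-sym z≢u , uz-nonadj)) u≁v (≢-sym y≢v , vy-nonadj))
            (∈-clique⇒adjacent clique z∈K y∈K (≢-sym y≢z))

    colouring : ∀ P → Acc _⊂_ P → (∀ {x} → x ∈ P → R x) → CliqueBoundedColouring P
    colouring P (acc rec) P⊆R with co-pair? P | nonempty? P
    ... | yes (u , v , u∈P , v∈P , u≁v@(_ , uv-nonadj)) | _ =
      [ extend-by u∈P , extend-by v∈P ]′
        (one-of-co-pair-complete P⊆R u∈P v∈P u≁v (clique-⊆ C) (clique-adjacent C))
      where
        C : CliqueBoundedColouring (P - u - v)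
        C = colouring (P - u - v) (rec (x∈p⇒p-x-y⊂p u∈P)) (P⊆R ∘ p-x-y⊆p)
        extend-by : ∀ {w} → w ∈ P → All (Adjacent w) (clique C) → CliqueBoundedColouring P
        extend-by w∈P w-C = extend p-x-y⊆p C w∈P w-C (removed-independent uv-nonadj)
    ... | no _ | no empty = empty-colouring empty
    ... | no no-co-pair | yes (u , u∈P) =
      extend p-x-y⊆p C u∈P (All.map u-adjacent (clique-⊆ C)) (removed-independent (irrefl G u))
      where
        C : CliqueBoundedColouring (P - u - u)
        C = colouring (P - u - u) (rec (x∈p⇒p-x-y⊂p u∈P)) (P⊆R ∘ p-x-y⊆p)
        u-adjacent : ∀ {z} → z ∈ P - u - u → Adjacent u z
        u-adjacent {z} z∈Q with Adj G u z ≟ᵇ false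
        ... | no ¬uz-nonadj = ¬-not ¬uz-nonadj
        ... | yes uz-nonadj =
          contradiction (u , z , u∈P , p-x-y⊆p z∈Q , ≢-sym (x∈p-y⇒x≢y z∈Q) , uz-nonadj) no-co-pair

  merge : ∀ {P Q} → (∀ {x y} → Adjacent x y → x ∈ P → y ∈ P) →
          (C : CliqueBoundedColouring P) (C′ : CliqueBoundedColouring Q) →
          length (clique C) ≤ length (clique C′) → CliqueBoundedColouring (P ∪ Q)
  merge {P} {Q} P-closed C C′ |C|≤|C′| = record
    { clique = clique C′
    ; clique-⊆ = All.map (x∈p∪q⁺ ∘ inj₂) (clique-⊆ C′)
    ; clique-adjacent = clique-adjacent C′
    ; colour = colour″
    ; colour-< = colour″-<
    ; colour-proper = colour″-proper
    }
    where
      ∈Q : ∀ {x} → x ∈ P ∪ Q → x ∉ P → x ∈ Q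
      ∈Q x∈P∪Q x∉P = [ flip contradiction x∉P , (λ x∈Q → x∈Q) ]′ (x∈p∪q⁻ P Q x∈P∪Q)

      colour″ : Fin n → ℕ
      colour″ x with x ∈? P
      ... | yes _ = colour C x
      ... | no _ = colour C′ x

      colour″-< : ∀ {x} → x ∈ P ∪ Q → colour″ x < length (clique C′)
      colour″-< {x} x∈P∪Q with x ∈? P
      ... | yes x∈P = <-≤-trans (colour-< C x∈P) |C|≤|C′|
      ... | no x∉P = colour-< C′ (∈Q x∈P∪Q x∉P)

      colour″-proper : ∀ {x y} → x ∈ P ∪ Q → y ∈ P ∪ Q → Adjacent x y → colour″ x ≢ colour″ y
      colour″-proper {x} {y} x∈P∪Q y∈P∪Q adj with x ∈? P | y ∈? P
      ... | yes x∈P | yes y∈P = colour-proper C x∈P y∈P adj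
      ... | yes x∈P | no y∉P  = contradiction (P-closed adj x∈P) y∉P
      ... | no x∉P  | yes y∈P = contradiction (P-closed (adjacent-sym adj) y∈P) x∉P
      ... | no x∉P  | no y∉P  = colour-proper C′ (∈Q x∈P∪Q x∉P) (∈Q y∈P∪Q y∉P) adj

  spanning⇒colourable∧clique : ∀ {P} → CliqueBoundedColouring P → (∀ x → x ∈ P) →
                               ∃[ k ] (Colorable G k × HasClique G k)
  spanning⇒colourable∧clique C spanning =
    length (clique C) ,
    bounded-colouring⇒Colorable (colour C) (λ x → colour-< C (spanning x))
      (λ x y → colour-proper C (spanning x) (spanning y)) ,
    clique⇒HasClique (clique-adjacent C)

  tabulate-closed : ∀ {g : Fin n → Bool} → (∀ {x y} → Adjacent x y → g x ≡ g y) →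
                    ∀ {x y} → Adjacent x y → x ∈ tabulate g → y ∈ tabulate g
  tabulate-closed g-respects adj x∈ = ∈-tabulate⁺ (trans (sym (g-respects adj)) (∈-tabulate⁻ x∈))

  partwise-coBiclique⇒colourable∧clique :
    (side : Fin n → Bool) → (∀ {x y} → Adjacent x y → side x ≡ side y) →
    (∀ b → IsCoBiclique (λ x → side x ≡ b)) → ∃[ k ] (Colorable G k × HasClique G k)
  partwise-coBiclique⇒colourable∧clique side adjacent⇒same-side coBiclique =
    [ (λ |C₁|≤|C₀| → spanning⇒colourable∧clique (merge P₁-closed C₁ C₀ |C₁|≤|C₀|) (x∈p∪q⁺ ∘ sides))
    , (λ |C₀|≤|C₁| → spanning⇒colourable∧clique (merge P₀-closed C₀ C₁ |C₀|≤|C₁|) (x∈p∪q⁺ ∘ swap ∘ sides))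
    ]′ (≤-total (length (clique C₁)) (length (clique C₀)))
    where
      P₁ P₀ : Subset n
      P₁ = tabulate side
      P₀ = tabulate (not ∘ side)
      C₁ : CliqueBoundedColouring P₁
      C₁ = colouring (coBiclique true) P₁ (⊂-wellFounded P₁) ∈-tabulate⁻
      C₀ : CliqueBoundedColouring P₀
      C₀ = colouring (coBiclique false) P₀ (⊂-wellFounded P₀) (not-injective ∘ ∈-tabulate⁻)
      P₁-closed : ∀ {x y} → Adjacent x y → x ∈ P₁ → y ∈ P₁
      P₁-closed = tabulate-closed adjacent⇒same-side
      P₀-closed : ∀ {x y} → Adjacent x y → x ∈ P₀ → y ∈ P₀
      P₀-closed = tabulate-closed (cong not ∘ adjacent⇒same-side)
      sides : ∀ x → x ∈ P₁ ⊎ x ∈ P₀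
      sides x with side x in side-x
      ... | true = inj₁ (∈-tabulate⁺ side-x)
      ... | false = inj₂ (∈-tabulate⁺ (cong not side-x))

edgeless⇒colourable∧clique : ∀ {n} (G : Graph n) → (∀ x y → Adj G x y ≡ false) →
                             ∃[ k ] (Colorable G k × HasClique G k)
edgeless⇒colourable∧clique {zero} G _ = 0 , ((λ ()) , λ ()) , ((λ ()) , (λ { {()} }) , λ ())
edgeless⇒colourable∧clique {suc n} G edgeless =
  1 ,
  ((λ _ → zero) , λ x y adj _ → nonadjacent⇒¬adjacent G (edgeless x y) adj) ,
  ((λ _ → zero) , (λ { {zero} {zero} _ → refl }) , λ { zero zero 0≢0 → contradiction refl 0≢0 })

induced-isCoBiclique : ∀ {n m} {G : Graph n} {R : Fin n → Set} {f : Fin m → Fin n} →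
                       Injective _≡_ _≡_ f → IsCoBiclique G R → IsCoBiclique (induced G f) (R ∘ f)
induced-isCoBiclique {G = G} {f = f} f-injective coBiclique = record
  { ≁-triangle-free = λ Rx Ry Rz x≁y y≁z x≁z → ≁-triangle-free Rx Ry Rz (image x≁y) (image y≁z) (image x≁z)
  ; ≁-path-closed = λ Rw Rx Ry Rz w≁x x≁y y≁z → ≁-path-closed Rw Rx Ry Rz (image w≁x) (image x≁y) (image y≁z)
  }
  where
    open IsCoBiclique coBiclique
    image : ∀ {i j} → _≁_ (induced G f) i j → _≁_ G (f i) (f j)
    image (i≢j , nonadj) = i≢j ∘ f-injective , nonadj

module NicheGraph {n : ℕ} (G : Graph n) (D : BipartiteTournament n) (niche : IsNicheGraphOf G D) where

  CommonNeighbour : Fin n → Fin n → Fin n → Set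
  CommonNeighbour x y w = (Arc D x w ≡ true × Arc D y w ≡ true) ⊎ (Arc D w x ≡ true × Arc D w y ≡ true)

  common-neighbour : ∀ {x y} → Adjacent G x y → ∃ (CommonNeighbour x y)
  common-neighbour {x} {y} adj = proj₂ (Equivalence.to (niche x y) adj)

  common-neighbour⇒adjacent : ∀ {x y w} → x ≢ y → CommonNeighbour x y w → Adjacent G x y
  common-neighbour⇒adjacent {x} {y} {w} x≢y common = Equivalence.from (niche x y) (x≢y , w , common)

  adjacent⇒same-part : ∀ {x y} → Adjacent G x y → part D x ≡ part D y
  adjacent⇒same-part {x} {y} adj with common-neighbour adj
  ... | w , inj₁ (x→w , y→w) = a≢c∧b≢c⇒a≡b (arc-cross D x w x→w) (arc-cross D y w y→w)
  ... | w , inj₂ (w→x , w→y) = a≢c∧b≢c⇒a≡b (≢-sym (arc-cross D w x w→x)) (≢-sym (arc-cross D w y w→y))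


  adjacent⇒vertex-outside : ∀ {x y} → Adjacent G x y → ∀ b → ∃[ w ] part D w ≢ b
  adjacent⇒vertex-outside {x} adj b with part D x ≟ᵇ b | common-neighbour adj
  ... | no x∉b  | _                      = x , x∉b
  ... | yes refl | w , inj₁ (x→w , _)    = w , ≢-sym (arc-cross D x w x→w)
  ... | yes refl | w , inj₂ (w→x , _)    = w , arc-cross D w x w→x

  Opposite : Bool → Fin n → Fin n → Set
  Opposite b x y = ∀ w → part D w ≢ b → Arc D x w ≡ not (Arc D y w)

  reverse-arc : ∀ {x w} → part D x ≢ part D w → Arc D x w ≡ false → Arc D w x ≡ true
  reverse-arc {x} {w} x∦w x↛w =
    [ (λ x→w → contradiction (trans (sym x→w) x↛w) λ ()) , (λ w→x → w→x) ]′ (arc-total D x w x∦w)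

  nonadjacent⇒opposite : ∀ {b x y} → part D x ≡ b → part D y ≡ b → _≁_ G x y → Opposite b x y
  nonadjacent⇒opposite {x = x} {y} refl y∈b (x≢y , nonadj) w w∉b with Arc D x w in x→w | Arc D y w in y→w
  ... | true  | false = refl
  ... | false | true  = refl
  ... | true  | true  =
    contradiction (common-neighbour⇒adjacent x≢y (inj₁ (x→w , y→w))) (nonadjacent⇒¬adjacent G nonadj)
  ... | false | false =
    contradiction (common-neighbour⇒adjacent x≢y (inj₂ (w→x , w→y))) (nonadjacent⇒¬adjacent G nonadj)
    where
      w→x : Arc D w x ≡ true
      w→x = reverse-arc (≢-sym w∉b) x→w
      w→y : Arc D w y ≡ true
      w→y = reverse-arc (λ y≡w → w∉b (trans (sym y≡w) y∈b)) y→w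

  opposite⇒nonadjacent : ∀ {b x y} → part D x ≡ b → Opposite b x y → Adj G x y ≡ false
  opposite⇒nonadjacent {x = x} {y} refl opposite = ¬-not λ adj → no-common-neighbour (common-neighbour adj)
    where
      no-common-neighbour : ¬ ∃ (CommonNeighbour x y)
      no-common-neighbour (w , inj₁ (x→w , y→w)) =
        contradiction (trans (sym x→w) (trans (opposite w (≢-sym (arc-cross D x w x→w))) (cong not y→w))) λ ()
      no-common-neighbour (w , inj₂ (w→x , w→y)) =
        contradiction
          (trans (sym (arc-asym D w x w→x)) (trans (opposite w (arc-cross D w x w→x)) (cong not (arc-asym D w y w→y))))
          λ ()

  opposite-opposite : ∀ {b x y z} → Opposite b x y → Opposite b y z →
                      ∀ w → part D w ≢ b → Arc D x w ≡ Arc D z w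
  opposite-opposite {x = x} {y} {z} x-y y-z w w∉b = begin
    Arc D x w             ≡⟨ x-y w w∉b ⟩
    not (Arc D y w)       ≡⟨ cong not (y-z w w∉b) ⟩
    not (not (Arc D z w)) ≡⟨ not-involutive _ ⟩
    Arc D z w             ∎
    where open ≡-Reasoning

  isCoBiclique : (∃₂ λ x y → Adjacent G x y) → ∀ b → IsCoBiclique G (λ x → part D x ≡ b)
  isCoBiclique (_ , _ , adj) b = record
    { ≁-triangle-free = λ x∈b y∈b z∈b x≁y y≁z x≁z →
        let w , w∉b = adjacent⇒vertex-outside adj b
            x-y = nonadjacent⇒opposite x∈b y∈b x≁y
            y-z = nonadjacent⇒opposite y∈b z∈b y≁z
            x-z = nonadjacent⇒opposite x∈b z∈b x≁z
        in not-¬ refl (trans (sym (opposite-opposite x-y y-z w w∉b)) (x-z w w∉b))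
    ; ≁-path-closed = λ w∈b x∈b y∈b z∈b w≁x x≁y y≁z →
        opposite⇒nonadjacent w∈b λ t t∉b →
          trans (opposite-opposite (nonadjacent⇒opposite w∈b x∈b w≁x) (nonadjacent⇒opposite x∈b y∈b x≁y)
                                   t t∉b)
                (nonadjacent⇒opposite y∈b z∈b y≁z t t∉b)
    }

corollary4p2 : (n : ℕ) (G : Graph n) → NicheRealizable G → Perfect G
corollary4p2 n G (D , niche) m f f-injective =
  map₂ (λ (col , clq) → colourable∧clique⇒χ≡ω H col clq) colourable∧clique
  where
    open NicheGraph G D niche

    H : Graph m
    H = induced G f

    colourable∧clique : ∃[ k ] (Colorable H k × HasClique H k)
    colourable∧clique with edge? G
    ... | no no-edge = edgeless⇒colourable∧clique H λ i j → ¬-not λ adj → no-edge (f i , f j , adj)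
    ... | yes edge   = partwise-coBiclique⇒colourable∧clique H (part D ∘ f) adjacent⇒same-part
                         λ b → induced-isCoBiclique f-injective (isCoBiclique edge b)
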